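{- If $G$ is a simple graph of order $n\geq 3$ with minimum degree $\delta(G)\geq \frac{n}{2}$, then $px_k(G)=2$ for each integer $k$ with $3\leq k\leq n$.
   Context: All graphs are finite, simple and undirected. An edge-coloring of a graph $G$ assigns colors to edges (adjacent edges may receive the same color). A tree in an edge-colored graph is a proper tree if any two adjacent edges of it receive different colors. For $S\subseteq V(G)$, an $S$-tree is a tree in $G$ containing all vertices of $S$. For a graph $G$ of order $n$ and an integer $k$ with $2\leq k\leq n$, an edge-coloring of $G$ is a $k$-proper coloring if for every set $S$ of $k$ vertices of $G$ there is a proper $S$-tree in $G$. The $k$-proper index $px_k(G)$ of a nontrivial connected graph $G$ is the smallest number of colors in a $k$-proper coloring of $G$. -}

module Defs where

open import Data.Nat using (ℕ; zero; suc; _+_; _*_; _≤_; _<_)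
open import Data.Fin using (Fin; toℕ)
open import Data.Bool using (Bool; true; false; if_then_else_)
open import Data.List using (List; []; _∷_; length; map; allFin)
open import Data.Nat.ListAction using (sum)
open import Data.List.Membership.Propositional using (_∈_)
open import Data.List.Relation.Unary.Unique.Propositional using (Unique)
open import Data.Product using (_×_; _,_; Σ; ∃; ∃-syntax)
open import Relation.Binary.PropositionalEquality using (_≡_; _≢_)
open import Relation.Nullary using (¬_)

record Graph (n : ℕ) : Set where
  field
    adj   : Fin n → Fin n → Bool
    sym   : ∀ u v → adj u v ≡ adj v u
    irrfl : ∀ v → adj v v ≡ false
open Graph public

degree : ∀ {n} → Graph n → Fin n → ℕ
degree {n} G v = sum (map (λ u → if adj G v u then 1 else 0) (allFin n))

-- δ(G) ≥ n/2, written without division: 2·deg(v) ≥ n for every vertex v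
MinDegreeAtLeastHalf : ∀ {n} → Graph n → Set
MinDegreeAtLeastHalf {n} G = ∀ v → n ≤ 2 * degree G v

-- An edge {u,v} of G, represented canonically as an ordered pair (u , v) with u < v.
Edge : ∀ {n} → Graph n → Fin n × Fin n → Set
Edge G (u , v) = (toℕ u < toℕ v) × (adj G u v ≡ true)

-- An edge-colouring of G with (at most) m colours; only the values on
-- canonical pairs (u , v) with u < v that are edges of G are relevant.
-- Adjacent edges may receive the same colour.
Coloring : ℕ → ℕ → Set
Coloring n m = Fin n × Fin n → Fin m

ShareEnd : ∀ {n} → Fin n × Fin n → Fin n × Fin n → Set
ShareEnd (a , b) (c , d) = (a ≡ c) Data.Sum.⊎ ((a ≡ d) Data.Sum.⊎ ((b ≡ c) Data.Sum.⊎ (b ≡ d)))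
  where import Data.Sum

data Reach {n : ℕ} (es : List (Fin n × Fin n)) : Fin n → Fin n → Set where
  here  : ∀ {u} → Reach es u u
  fwd   : ∀ {u v w} → (u , v) ∈ es → Reach es v w → Reach es u w
  bwd   : ∀ {u v w} → (v , u) ∈ es → Reach es v w → Reach es u w

-- A tree in G: a subgraph with vertex list vs and edge list es (distinct,
-- no repeated vertices/edges), every edge an edge of G with both ends in vs,
-- connected, nonempty, and with |E| = |V| - 1 (i.e. connected and acyclic).
record Tree {n : ℕ} (G : Graph n) : Set where
  field
    vs      : List (Fin n)
    es      : List (Fin n × Fin n)
    vsUniq  : Unique vs
    esUniq  : Unique es
    esEdge  : ∀ {e} → e ∈ es → Edge G e
    esEnds  : ∀ {u v} → (u , v) ∈ es → (u ∈ vs) × (v ∈ vs)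
    size    : length es + 1 ≡ length vs
    conn    : ∀ {u v} → u ∈ vs → v ∈ vs → Reach es u v
open Tree public

ProperTree : ∀ {n m} {G : Graph n} → Coloring n m → Tree G → Set
ProperTree c T = ∀ {e f} → e ∈ es T → f ∈ es T → e ≢ f → ShareEnd e f → c e ≢ c f

KSet : ℕ → ℕ → Set
KSet n k = Σ (List (Fin n)) λ S → Unique S × (length S ≡ k)

KProperColoring : ∀ {n m} → Graph n → ℕ → Coloring n m → Set
KProperColoring {n} G k c =
  (S : KSet n k) → Σ (Tree G) λ T → ProperTree c T × (∀ {x} → x ∈ Data.Product.proj₁ S → x ∈ vs T)
  where import Data.Product

PxEq : ∀ {n} → Graph n → ℕ → ℕ → Set
PxEq {n} G k m =
  (Σ (Coloring n m) λ c → KProperColoring G k c) ×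
  (∀ m′ → m′ < m → (c : Coloring n m′) → ¬ KProperColoring G k c)

-- Half the order as minimum degree gives deg u + deg v ≥ n for all u, v. Then a simple path
-- a ⋯ b on fewer than n vertices whose ends have no neighbour off the path contains
-- consecutive y z with b ~ y and a ~ z (pigeonhole), so its vertices form a cycle; a vertex
-- off the path has a neighbour on it (again by counting), and opening the cycle there gives
-- a longer path. Hence G has a Hamiltonian path, and colouring its edges alternately makes it
-- a proper spanning tree: px_k(G) ≤ 2. Conversely, a tree on k ≥ 3 vertices has two
-- adjacent edges, so one colour never suffices.
module Submission where

open import Defs hiding (sym)
open import Data.Nat using (ℕ; zero; suc; _+_; _*_; _∸_; _⊓_; _≤_; _<_; z≤n; s≤s; _<?_)
open import Data.Nat.Properties
open import Data.Nat.ListAction using (sum)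
open import Data.Bool using (Bool; true; false; if_then_else_) renaming (_≟_ to _≟ᵇ_)
open import Data.Fin using (Fin; zero; suc; toℕ; fromℕ<; opposite) renaming (_≟_ to _≟ᶠ_)
open import Data.Fin.Properties using (toℕ-injective)
open import Data.List using (List; []; _∷_; [_]; length; map; allFin; filter; reverse; take; _++_)
open import Data.List.Properties using (length-++; length-tabulate; length-take; length-++-sucʳ)
open import Data.List.Membership.Propositional using (_∈_; _∉_; find)
open import Data.List.Membership.Propositional.Properties using (∈-++⁻; ∈-++⁺ˡ; ∈-++⁺ʳ; ∈-∃++; ∈-allFin; ∈-filter⁻; ∈-filter⁺)
open import Data.List.Relation.Binary.Subset.Propositional using (_⊆_)
open import Data.List.Relation.Binary.Disjoint.Propositional using (Disjoint)
open import Data.List.Relation.Unary.Any as Any using (Any; here; there; any?)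
open import Data.List.Relation.Unary.All as All using (All; _∷_; all?)
open import Data.List.Relation.Unary.All.Properties using (¬Any⇒All¬; ¬All⇒Any¬)
open import Data.List.Relation.Unary.AllPairs using ([]; _∷_)
open import Data.List.Relation.Unary.Unique.Propositional using (Unique)
open import Data.List.Relation.Unary.Unique.Propositional.Properties using (allFin⁺; filter⁺; take⁺; ++⁺)
open import Data.List.Relation.Binary.Permutation.Propositional using (_↭_; ↭-refl; ↭-sym; ↭⇒↭ₛ)
open import Data.List.Relation.Binary.Permutation.Propositional.Properties using (∈-resp-↭; ↭-length; ++-comm; ↭-reverse; ++⁺ʳ; ∷↭∷ʳ)
import Data.List.Relation.Binary.Permutation.Setoid.Properties as PermutationSetoid
open import Data.Product using (Σ; ∃; ∃₂; _×_; _,_; proj₁; proj₂)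
open import Data.Product.Properties using (≡-dec)
open import Data.Sum using (_⊎_; inj₁; inj₂)
open import Function using (_∘_)
open import Relation.Binary.PropositionalEquality using (_≡_; _≢_; refl; sym; trans; cong; cong₂; subst; setoid; module ≡-Reasoning)
open import Relation.Nullary using (¬_; Dec; yes; no; does; contradiction)
open import Relation.Nullary.Decidable using (dec-true; dec-false)

≤-half-sum : ∀ {n} x y → n ≤ 2 * x → n ≤ 2 * y → n ≤ x + y
≤-half-sum {n} x y n≤2x n≤2y = *-cancelˡ-≤ 2 (begin
  2 * n           ≡⟨ cong (n +_) (+-identityʳ n) ⟩
  n + n           ≤⟨ +-mono-≤ n≤2x n≤2y ⟩
  2 * x + 2 * y   ≡⟨ *-distribˡ-+ 2 x y ⟨
  2 * (x + y)     ∎)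
  where open ≤-Reasoning

count : {A : Set} → (A → Bool) → List A → ℕ
count P xs = sum (map (λ x → if P x then 1 else 0) xs)

count≡length-filter : {A : Set} (P : A → Bool) (xs : List A) →
                      count P xs ≡ length (filter ((_≟ᵇ true) ∘ P) xs)
count≡length-filter P [] = refl
count≡length-filter P (x ∷ xs) with P x
... | true  = cong suc (count≡length-filter P xs)
... | false = count≡length-filter P xs

∉⇒Unique-∷ : {A : Set} {x : A} {xs : List A} → x ∉ xs → Unique xs → Unique (x ∷ xs)
∉⇒Unique-∷ x∉xs u = ¬Any⇒All¬ _ x∉xs ∷ u

Unique-resp-↭ : {A : Set} {xs ys : List A} → xs ↭ ys → Unique xs → Unique ys
Unique-resp-↭ {A} xs↭ys = PermutationSetoid.Unique-resp-↭ (setoid A) (↭⇒↭ₛ xs↭ys)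

Unique⇒length≤ : {A : Set} {xs ys : List A} → Unique xs → xs ⊆ ys → length xs ≤ length ys
Unique⇒length≤ {xs = []} _ _ = z≤n
Unique⇒length≤ {xs = x ∷ xs} (x∉xs ∷ u) xs⊆ys with ∈-∃++ (xs⊆ys (here refl))
... | as , bs , refl = begin
  suc (length xs)           ≤⟨ s≤s (Unique⇒length≤ u xs⊆as++bs) ⟩
  suc (length (as ++ bs))   ≡⟨ length-++-sucʳ as x bs ⟨
  length (as ++ x ∷ bs)     ∎
  where
  open ≤-Reasoning
  xs⊆as++bs : xs ⊆ as ++ bs
  xs⊆as++bs z∈xs with ∈-++⁻ as (xs⊆ys (there z∈xs))
  ... | inj₁ z∈as         = ∈-++⁺ˡ z∈as
  ... | inj₂ (here refl)  = contradiction refl (All.lookup x∉xs z∈xs)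
  ... | inj₂ (there z∈bs) = ∈-++⁺ʳ as z∈bs

nonempty⇒∃∈ : {A : Set} (xs : List A) → 0 < length xs → ∃ (_∈ xs)
nonempty⇒∃∈ (x ∷ _) _ = x , here refl

module _ {n : ℕ} where
  open import Data.List.Membership.DecPropositional (_≟ᶠ_ {n}) using (_∈?_)

  length-allFin : length (allFin n) ≡ n
  length-allFin = length-tabulate (λ i → i)

  Unique⇒length≤order : {l : List (Fin n)} → Unique l → length l ≤ n
  Unique⇒length≤order {l} u = subst (length l ≤_) length-allFin (Unique⇒length≤ u (λ {v} _ → ∈-allFin v))

  ∈-complete : {l : List (Fin n)} → Unique l → length l ≡ n → (v : Fin n) → v ∈ l
  ∈-complete {l} u |l|≡n v with v ∈? l
  ... | yes v∈l = v∈l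
  ... | no  v∉l = contradiction (Unique⇒length≤order (∉⇒Unique-∷ v∉l u))
                                (subst (λ m → ¬ suc m ≤ n) (sym |l|≡n) (n≮n n))

  ∃-∉ : (l : List (Fin n)) → length l < n → ∃ (_∉ l)
  ∃-∉ l |l|<n with all? (_∈? l) (allFin n)
  ... | yes all∈l = contradiction (subst (_≤ length l) length-allFin (Unique⇒length≤ (allFin⁺ n) (All.lookup all∈l)))
                                  (<⇒≱ |l|<n)
  ... | no  ¬all  = let v , _ , v∉l = find (¬All⇒Any¬ (_∈? l) (allFin n) ¬all) in v , v∉l

  ∃-outside-pair : {vs : List (Fin n)} → Unique vs → 3 ≤ length vs →
                   (a b : Fin n) → ∃ λ w → w ∈ vs × w ∉ a ∷ b ∷ []
  ∃-outside-pair {vs} u 3≤|vs| a b with all? (_∈? a ∷ b ∷ []) vs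
  ... | yes vs⊆ab = contradiction (Unique⇒length≤ u (All.lookup vs⊆ab)) (<⇒≱ 3≤|vs|)
  ... | no  vs⊈ab = find (¬All⇒Any¬ (_∈? a ∷ b ∷ []) vs vs⊈ab)

  initialSegment : ∀ {k} → k ≤ n → KSet n k
  initialSegment {k} k≤n = take k (allFin n) , take⁺ k (allFin⁺ n) , (begin
    length (take k (allFin n))   ≡⟨ length-take k (allFin n) ⟩
    k ⊓ length (allFin n)        ≡⟨ cong (k ⊓_) length-allFin ⟩
    k ⊓ n                        ≡⟨ m≤n⇒m⊓n≡m k≤n ⟩
    k                            ∎)
    where open ≡-Reasoning

  KSet-length≤ : ∀ {k xs} (S : KSet n k) → proj₁ S ⊆ xs → k ≤ length xs
  KSet-length≤ (S , u , |S|≡k) S⊆xs = subst (_≤ _) |S|≡k (Unique⇒length≤ u S⊆xs)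

Fin<2-irrelevant : ∀ {m} → m < 2 → (i j : Fin m) → i ≡ j
Fin<2-irrelevant {1} _ zero zero = refl
Fin<2-irrelevant {suc (suc _)} (s≤s (s≤s ()))

module _ {n : ℕ} (G : Graph n) where
  open import Data.List.Membership.DecPropositional (_≟ᶠ_ {n}) using (_∈?_)

  _~_ : Fin n → Fin n → Set
  u ~ v = adj G u v ≡ true

  ~-sym : ∀ {u v} → u ~ v → v ~ u
  ~-sym {u} {v} = trans (Graph.sym G v u)

  ~-irrefl : ∀ {v} → ¬ v ~ v
  ~-irrefl {v} v~v with () ← trans (sym (irrfl G v)) v~v

  _~?_ : ∀ v w → Dec (v ~ w)
  v ~? w = adj G v w ≟ᵇ true

  neighbours : Fin n → List (Fin n)
  neighbours v = filter (v ~?_) (allFin n)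

  ∈-neighbours⁺ : ∀ {v w} → v ~ w → w ∈ neighbours v
  ∈-neighbours⁺ {w = w} v~w = ∈-filter⁺ (_ ~?_) (∈-allFin w) v~w

  ∈-neighbours⁻ : ∀ {v w} → w ∈ neighbours v → v ~ w
  ∈-neighbours⁻ w∈N = proj₂ (∈-filter⁻ (_ ~?_) {xs = allFin n} w∈N)

  neighbours-unique : ∀ v → Unique (neighbours v)
  neighbours-unique v = filter⁺ (v ~?_) (allFin⁺ n)

  degree≡length-neighbours : ∀ v → degree G v ≡ length (neighbours v)
  degree≡length-neighbours v = count≡length-filter (adj G v) (allFin n)

  degree≤count : ∀ {v l} → neighbours v ⊆ l → degree G v ≤ count (adj G v) l
  degree≤count {v} {l} N⊆l = begin
    degree G v                                 ≡⟨ degree≡length-neighbours v ⟩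
    length (neighbours v)                      ≤⟨ Unique⇒length≤ (neighbours-unique v) N⊆filter ⟩
    length (filter (v ~?_) l)   ≡⟨ count≡length-filter (adj G v) l ⟨
    count (adj G v) l                          ∎
    where
    open ≤-Reasoning
    N⊆filter : neighbours v ⊆ filter (v ~?_) l
    N⊆filter w∈N = ∈-filter⁺ (v ~?_) (N⊆l w∈N) (∈-neighbours⁻ w∈N)

  neighbours-⊆-or-exit : ∀ v l → neighbours v ⊆ l ⊎ ∃ λ w → v ~ w × w ∉ l
  neighbours-⊆-or-exit v l with all? (_∈? l) (neighbours v)
  ... | yes N⊆l = inj₁ (All.lookup N⊆l)
  ... | no  N⊈l = let w , w∈N , w∉l = find (¬All⇒Any¬ (_∈? l) (neighbours v) N⊈l)
                  in inj₂ (w , ∈-neighbours⁻ w∈N , w∉l)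

  2+degree-sum≤order : ∀ {a w} → a ≢ w → ¬ a ~ w → Disjoint (neighbours a) (neighbours w) →
                       2 + (degree G a + degree G w) ≤ n
  2+degree-sum≤order {a} {w} a≢w a≁w N∩N≡∅ = begin
    2 + (degree G a + degree G w)
      ≡⟨ cong (2 +_) (cong₂ _+_ (degree≡length-neighbours a) (degree≡length-neighbours w)) ⟩
    2 + (length (neighbours a) + length (neighbours w))
      ≡⟨ cong (2 +_) (length-++ (neighbours a)) ⟨
    length (a ∷ w ∷ neighbours a ++ neighbours w)
      ≤⟨ Unique⇒length≤order (∉⇒Unique-∷ a∉ (∉⇒Unique-∷ w∉ N++N-unique)) ⟩
    n
      ∎
    where
    open ≤-Reasoning
    N++N-unique : Unique (neighbours a ++ neighbours w)
    N++N-unique = ++⁺ (neighbours-unique a) (neighbours-unique w) N∩N≡∅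
    w∉ : w ∉ neighbours a ++ neighbours w
    w∉ w∈ with ∈-++⁻ (neighbours a) w∈
    ... | inj₁ w∈Na = a≁w (∈-neighbours⁻ w∈Na)
    ... | inj₂ w∈Nw = ~-irrefl (∈-neighbours⁻ w∈Nw)
    a∉ : a ∉ w ∷ neighbours a ++ neighbours w
    a∉ (here a≡w) = a≢w a≡w
    a∉ (there a∈) with ∈-++⁻ (neighbours a) a∈
    ... | inj₁ a∈Na = ~-irrefl (∈-neighbours⁻ a∈Na)
    ... | inj₂ a∈Nw = a≁w (~-sym (∈-neighbours⁻ a∈Nw))

  DegreeSumsAtLeastOrder : Set
  DegreeSumsAtLeastOrder = ∀ u v → n ≤ degree G u + degree G v

  minDegree⇒degreeSums : MinDegreeAtLeastHalf G → DegreeSumsAtLeastOrder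
  minDegree⇒degreeSums δ u v = ≤-half-sum (degree G u) (degree G v) (δ u) (δ v)

  infixr 5 _◅_
  data Path : Fin n → Fin n → List (Fin n) → Set where
    single : ∀ x → Path x x [ x ]
    _◅_    : ∀ {x y z l} → x ~ y → Path y z l → Path x z (x ∷ l)

  head∈ : ∀ {s t l} → Path s t l → s ∈ l
  head∈ (single _) = here refl
  head∈ (_ ◅ _)    = here refl

  head≡ : ∀ {s t x l} → Path s t (x ∷ l) → s ≡ x
  head≡ (single _) = refl
  head≡ (_ ◅ _)    = refl

  joinₚ : ∀ {x y z w l l′} → Path x y l → y ~ z → Path z w l′ → Path x w (l ++ l′)
  joinₚ (single _) y~z q = y~z ◅ q
  joinₚ (x~x′ ◅ p) y~z q = x~x′ ◅ joinₚ p y~z q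

  reverseₚ : ∀ {x y l} → Path x y l → Path y x (reverse l)
  reverseₚ (single x) = single x
  reverseₚ (_◅_ {x} {l = l} x~y p) =
    subst (Path _ x) (sym (unfold-reverse x l)) (joinₚ (reverseₚ p) (~-sym x~y) (single x))
    where open import Data.List.Properties using (unfold-reverse)

  splitₚ : ∀ cs {s t x ds} → Path s t (cs ++ x ∷ ds) →
           Path x t (x ∷ ds) × (cs ≡ [] ⊎ ∃ λ u → Path s u cs)
  splitₚ []               (single _) = single _ , inj₁ refl
  splitₚ []               (x~y ◅ p)  = x~y ◅ p , inj₁ refl
  splitₚ (c ∷ [])         (c~y ◅ p) with refl ← head≡ p = p , inj₂ (c , single c)
  splitₚ (c ∷ c′ ∷ cs)    (c~c′ ◅ p) with splitₚ (c′ ∷ cs) p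
  ... | x-t , inj₁ ()
  ... | x-t , inj₂ (u , c′-u) = x-t , inj₂ (u , c~c′ ◅ c′-u)

  record Crossing (P Q : Fin n → Bool) (s t : Fin n) (l : List (Fin n)) : Set where
    constructor crossing
    field
      {y z}      : Fin n
      front back : List (Fin n)
      front-path : Path s y front
      back-path  : Path z t back
      split      : l ≡ front ++ back
      Q-y        : Q y ≡ true
      P-z        : P z ≡ true

  crossing-∷ : ∀ {P Q x z t l} → x ~ z → Crossing P Q z t l → Crossing P Q x t (x ∷ l)
  crossing-∷ {x = x} x~z (crossing f b fp bp eq Qy Pz) =
    crossing (x ∷ f) b (x~z ◅ fp) bp (cong (x ∷_) eq) Qy Pz

  -- Pigeonhole over the |l| - 1 consecutive pairs (y , z) of the path: Q counts
  -- the first components (Q t fails) and P the second ones (P s fails).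
  findCrossing : ∀ P Q {s t l} → Path s t l → P s ≡ false → Q t ≡ false →
                 length l ≤ count P l + count Q l → Crossing P Q s t l
  findCrossing P Q {t = t} p Ps Qt bound = go p false Ps bound
    where
    drop-head : ∀ ι {L c X} → ι + suc L ≤ (ι + c) + X → suc L ≤ c + X
    drop-head ι {L} {c} {X} h = +-cancelˡ-≤ ι (suc L) (c + X) (≤-trans h (≤-reflexive (+-assoc ι c X)))

    go : ∀ {s l} → Path s t l → ∀ b → P s ≡ b →
         (if b then 1 else 0) + length l ≤ count P l + count Q l → Crossing P Q s t l
    go (single s) _ refl h with () ← subst (λ b → 1 ≤ (if b then 1 else 0) + 0) Qt (drop-head _ h)
    go (_◅_ {x} {z} {l = l} x~z p) _ refl h with Q x in Qx | P z in Pz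
    ... | true  | true  = crossing [ x ] l (single x) p refl Qx Pz
    ... | true  | false = crossing-∷ x~z (go p false Pz (≤-pred (subst (suc (length l) ≤_)
                                                                   (+-suc (count P l) (count Q l)) (drop-head _ h))))
    ... | false | true  = crossing-∷ x~z (go p true Pz (drop-head _ h))
    ... | false | false = crossing-∷ x~z (go p false Pz (<⇒≤ (drop-head _ h)))

  record Cycle (l : List (Fin n)) : Set where
    constructor cycle
    field
      {start end} : Fin n
      path        : Path start end l
      closing     : end ~ start

  -- The crossing (b ~ y, a ~ z) turns a ⋯ y z ⋯ b into the cycle y ⋯ a z ⋯ b y.
  closeIntoCycle : DegreeSumsAtLeastOrder → ∀ {a b l} → Path a b l → length l ≤ n →
                   neighbours a ⊆ l → neighbours b ⊆ l → ∃ λ l′ → l′ ↭ l × Cycle l′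
  closeIntoCycle dense {a} {b} {l} p |l|≤n Na⊆l Nb⊆l
    with findCrossing (adj G a) (adj G b) p (irrfl G a) (irrfl G b) bound
    where
    bound : length l ≤ count (adj G a) l + count (adj G b) l
    bound = ≤-trans |l|≤n (≤-trans (dense a b) (+-mono-≤ (degree≤count Na⊆l) (degree≤count Nb⊆l)))
  ... | crossing front back a-y z-b refl b~y a~z =
    reverse front ++ back , ++⁺ʳ back (↭-reverse front) , cycle (joinₚ (reverseₚ a-y) a~z z-b) b~y

  openAt : ∀ {l x} → Cycle l → x ∈ l → ∃₂ λ t l′ → l′ ↭ l × Path x t l′
  openAt (cycle p t~s) x∈l with ∈-∃++ x∈l
  ... | cs , ds , refl with splitₚ cs p
  ...   | x-t , inj₁ refl          = _ , _ , ↭-refl , x-t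
  ...   | x-t , inj₂ (_ , s-u)     = _ , _ , ++-comm _ cs , joinₚ x-t t~s s-u

  -- Were w to have no neighbour in l, then a, w, N(a) and N(w) would be disjoint.
  hasNeighbourIn : DegreeSumsAtLeastOrder → ∀ {a w l} → a ∈ l → w ∉ l → neighbours a ⊆ l → Any (w ~_) l
  hasNeighbourIn dense {a} {w} {l} a∈l w∉l Na⊆l with any? (w ~?_) l
  ... | yes w~l = w~l
  ... | no  w≁l = contradiction (dense a w) (<⇒≱ (<⇒≤ (2+degree-sum≤order a≢w a≁w N∩N≡∅)))
    where
    a≢w : a ≢ w
    a≢w refl = w∉l a∈l
    a≁w : ¬ a ~ w
    a≁w = w∉l ∘ Na⊆l ∘ ∈-neighbours⁺
    N∩N≡∅ : Disjoint (neighbours a) (neighbours w)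
    N∩N≡∅ (v∈Na , v∈Nw) = w≁l (Any.map (λ { refl → ∈-neighbours⁻ v∈Nw }) (Na⊆l v∈Na))

  record SimplePath (m : ℕ) : Set where
    constructor simplePath
    field
      {start end} : Fin n
      vertices    : List (Fin n)
      path        : Path start end vertices
      distinct    : Unique vertices
      size        : length vertices ≡ m

  extendThroughCycle : DegreeSumsAtLeastOrder → ∀ {a w l} → Cycle l → Unique l → a ∈ l →
                       neighbours a ⊆ l → w ∉ l → SimplePath (suc (length l))
  extendThroughCycle dense C u a∈l Na⊆l w∉l
    with find (hasNeighbourIn dense a∈l w∉l Na⊆l)
  ... | x , x∈l , w~x with openAt C x∈l
  ...   | _ , l′ , l′↭l , x-t =
    simplePath _ (w~x ◅ x-t) (∉⇒Unique-∷ (w∉l ∘ ∈-resp-↭ l′↭l) (Unique-resp-↭ (↭-sym l′↭l) u))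
               (cong suc (↭-length l′↭l))

  longerPath : DegreeSumsAtLeastOrder → ∀ {m} → SimplePath m → m < n → SimplePath (suc m)
  longerPath dense (simplePath {a} {b} l p u refl) |l|<n with neighbours-⊆-or-exit a l
  ... | inj₂ (w , a~w , w∉l) = simplePath _ (~-sym a~w ◅ p) (∉⇒Unique-∷ w∉l u) refl
  ... | inj₁ Na⊆l with neighbours-⊆-or-exit b l
  ...   | inj₂ (w , b~w , w∉l) =
    simplePath _ (joinₚ p b~w (single w)) (Unique-resp-↭ (∷↭∷ʳ w l) (∉⇒Unique-∷ w∉l u))
               (trans (length-++ l) (+-comm (length l) 1))
  ...   | inj₁ Nb⊆l with closeIntoCycle dense p (<⇒≤ |l|<n) Na⊆l Nb⊆l | ∃-∉ l |l|<n
  ...     | l′ , l′↭l , C | w , w∉l =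
    subst SimplePath (cong suc (↭-length l′↭l))
      (extendThroughCycle dense C (Unique-resp-↭ (↭-sym l′↭l) u) (∈-resp-↭ (↭-sym l′↭l) (head∈ p))
                          (∈-resp-↭ (↭-sym l′↭l) ∘ Na⊆l) (w∉l ∘ ∈-resp-↭ l′↭l))

  hamiltonianPath : DegreeSumsAtLeastOrder → 0 < n → SimplePath n
  hamiltonianPath dense 0<n =
    grow (n ∸ 1) (m∸n+n≡m 0<n) (simplePath _ (single (fromℕ< 0<n)) (∉⇒Unique-∷ (λ ()) []) refl)
    where
    grow : ∀ d {m} → d + m ≡ n → SimplePath m → SimplePath n
    grow zero    refl P = P
    grow (suc d) {m} d+m≡n P =
      grow d (trans (+-suc d m) d+m≡n) (longerPath dense P (≤-trans (s≤s (m≤n+m m d)) (≤-reflexive d+m≡n)))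

  canonical : Fin n → Fin n → Fin n × Fin n
  canonical x y with toℕ x <? toℕ y
  ... | yes _ = x , y
  ... | no  _ = y , x

  canonical-edge : ∀ {x y} → x ~ y → Edge G (canonical x y)
  canonical-edge {x} {y} x~y with toℕ x <? toℕ y
  ... | yes x<y = x<y , x~y
  ... | no  x≮y = ≤∧≢⇒< (≮⇒≥ x≮y) (λ y≡x → ~-irrefl (subst (x ~_) (toℕ-injective y≡x) x~y)) , ~-sym x~y

  ends : Fin n × Fin n → List (Fin n)
  ends (u , v) = u ∷ v ∷ []

  ends-canonical : ∀ x y → ends (canonical x y) ⊆ x ∷ y ∷ []
  ends-canonical x y with toℕ x <? toℕ y
  ... | yes _ = λ v∈ → v∈
  ... | no  _ = λ { (here refl) → there (here refl) ; (there (here refl)) → here refl }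

  ∈-ends-canonical : ∀ x y → x ∈ ends (canonical x y)
  ∈-ends-canonical x y with toℕ x <? toℕ y
  ... | yes _ = here refl
  ... | no  _ = there (here refl)

  ShareEnd⇒common : ∀ {e f} → ShareEnd e f → ∃ λ v → v ∈ ends e × v ∈ ends f
  ShareEnd⇒common (inj₁ a≡c)                 = _ , here refl , here a≡c
  ShareEnd⇒common (inj₂ (inj₁ a≡d))          = _ , here refl , there (here a≡d)
  ShareEnd⇒common (inj₂ (inj₂ (inj₁ b≡c)))   = _ , there (here refl) , here b≡c
  ShareEnd⇒common (inj₂ (inj₂ (inj₂ b≡d)))   = _ , there (here refl) , there (here b≡d)

  pathEdges : List (Fin n) → List (Fin n × Fin n)
  pathEdges (x ∷ y ∷ r) = canonical x y ∷ pathEdges (y ∷ r)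
  pathEdges _           = []

  ends⊆ : ∀ {l e} → e ∈ pathEdges l → ends e ⊆ l
  ends⊆ {x ∷ y ∷ r} (here refl) = ∈-++⁺ˡ ∘ ends-canonical x y
  ends⊆ {x ∷ y ∷ r} (there e∈)  = there ∘ ends⊆ e∈

  headEdge∉tail : ∀ {x y r} → Unique (x ∷ y ∷ r) → canonical x y ∉ pathEdges (y ∷ r)
  headEdge∉tail {x} {y} (x∉ ∷ _) e∈ = All.lookup x∉ (ends⊆ e∈ (∈-ends-canonical x y)) refl

  tail≢head : ∀ {x y r e} → Unique (x ∷ y ∷ r) → e ∈ pathEdges (y ∷ r) → e ≢ canonical x y
  tail≢head u e∈ refl = headEdge∉tail u e∈

  pathEdges-unique : ∀ {l} → Unique l → Unique (pathEdges l)
  pathEdges-unique {x ∷ y ∷ r} u@(_ ∷ u′) = ∉⇒Unique-∷ (headEdge∉tail u) (pathEdges-unique u′)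
  pathEdges-unique {[]}        _ = []
  pathEdges-unique {_ ∷ []}    _ = []

  pathEdges-edge : ∀ {s t l e} → Path s t l → e ∈ pathEdges l → Edge G e
  pathEdges-edge (x~y ◅ single _) (here refl) = canonical-edge x~y
  pathEdges-edge (x~y ◅ _ ◅ _)    (here refl) = canonical-edge x~y
  pathEdges-edge (_ ◅ p@(_ ◅ _))  (there e∈)  = pathEdges-edge p e∈

  pathEdges-size : ∀ x r → length (pathEdges (x ∷ r)) + 1 ≡ length (x ∷ r)
  pathEdges-size x []      = refl
  pathEdges-size x (y ∷ r) = cong suc (pathEdges-size y r)

  Reach-trans : ∀ {es : List (Fin n × Fin n)} {u v w} → Reach es u v → Reach es v w → Reach es u w
  Reach-trans here      q = q
  Reach-trans (fwd e r) q = fwd e (Reach-trans r q)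
  Reach-trans (bwd e r) q = bwd e (Reach-trans r q)

  Reach-sym : ∀ {es : List (Fin n × Fin n)} {u v} → Reach es u v → Reach es v u
  Reach-sym here      = here
  Reach-sym (fwd e r) = Reach-trans (Reach-sym r) (bwd e here)
  Reach-sym (bwd e r) = Reach-trans (Reach-sym r) (fwd e here)

  Reach-mono : ∀ {es es′ : List (Fin n × Fin n)} → es ⊆ es′ → ∀ {u v} → Reach es u v → Reach es′ u v
  Reach-mono es⊆ here      = here
  Reach-mono es⊆ (fwd e r) = fwd (es⊆ e) (Reach-mono es⊆ r)
  Reach-mono es⊆ (bwd e r) = bwd (es⊆ e) (Reach-mono es⊆ r)

  Reach-canonical : ∀ {es : List (Fin n × Fin n)} {x y} → canonical x y ∈ es → Reach es y x
  Reach-canonical {x = x} {y} e∈ with toℕ x <? toℕ y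
  ... | yes _ = bwd e∈ here
  ... | no  _ = fwd e∈ here

  Reach-head : ∀ x r {u} → u ∈ x ∷ r → Reach (pathEdges (x ∷ r)) u x
  Reach-head x r       (here refl) = here
  Reach-head x (y ∷ r) (there u∈)  =
    Reach-trans (Reach-mono there (Reach-head y r u∈)) (Reach-canonical (here refl))

  pathTree : ∀ {s t x r} → Path s t (x ∷ r) → Unique (x ∷ r) → Tree G
  pathTree {x = x} {r} p u = record
    { vs     = x ∷ r
    ; es     = pathEdges (x ∷ r)
    ; vsUniq = u
    ; esUniq = pathEdges-unique u
    ; esEdge = pathEdges-edge p
    ; esEnds = λ e∈ → ends⊆ e∈ (here refl) , ends⊆ e∈ (there (here refl))
    ; size   = pathEdges-size x r
    ; conn   = λ u∈ v∈ → Reach-trans (Reach-head x r u∈) (Reach-sym (Reach-head x r v∈))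
    }

  _≟ₑ_ : (e f : Fin n × Fin n) → Dec (e ≡ f)
  _≟ₑ_ = ≡-dec _≟ᶠ_ _≟ᶠ_

  alternating : List (Fin n × Fin n) → Fin 2 → Fin n × Fin n → Fin 2
  alternating []       i e = i
  alternating (f ∷ fs) i e = if does (e ≟ₑ f) then i else alternating fs (opposite i) e

  alternating-here : ∀ {f} fs i → alternating (f ∷ fs) i f ≡ i
  alternating-here {f} _ i rewrite dec-true (f ≟ₑ f) refl = refl

  alternating-there : ∀ {e f} fs i → e ≢ f → alternating (f ∷ fs) i e ≡ alternating fs (opposite i) e
  alternating-there {e} {f} _ i e≢f rewrite dec-false (e ≟ₑ f) e≢f = refl

  opposite≢ : (i : Fin 2) → i ≢ opposite i
  opposite≢ zero       ()
  opposite≢ (suc zero) ()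

  -- Only the next edge can meet the first one, as the vertices of the path are distinct.
  alternating-head≢ : ∀ {x y r f v} i → Unique (x ∷ y ∷ r) → f ∈ pathEdges (y ∷ r) →
                      v ∈ ends (canonical x y) → v ∈ ends f →
                      alternating (pathEdges (x ∷ y ∷ r)) i (canonical x y) ≢
                      alternating (pathEdges (x ∷ y ∷ r)) i f
  alternating-head≢ {x} {y} {z ∷ r} i u (here refl) _ _ same = opposite≢ i (begin
    i
      ≡⟨ alternating-here {canonical x y} (pathEdges (y ∷ z ∷ r)) i ⟨
    alternating (pathEdges (x ∷ y ∷ z ∷ r)) i (canonical x y)
      ≡⟨ same ⟩
    alternating (pathEdges (x ∷ y ∷ z ∷ r)) i (canonical y z)
      ≡⟨ alternating-there (pathEdges (y ∷ z ∷ r)) i (tail≢head u (here refl)) ⟩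
    alternating (pathEdges (y ∷ z ∷ r)) (opposite i) (canonical y z)
      ≡⟨ alternating-here (pathEdges (z ∷ r)) (opposite i) ⟩
    opposite i
      ∎)
    where open ≡-Reasoning
  alternating-head≢ {x} {y} {z ∷ r} i ((_ ∷ x∉) ∷ (y∉ ∷ _)) (there f∈) v∈e v∈f
    with ends-canonical x y v∈e | ends⊆ f∈ v∈f
  ... | here refl         | v∈zr = contradiction refl (All.lookup x∉ v∈zr)
  ... | there (here refl) | v∈zr = contradiction refl (All.lookup y∉ v∈zr)

  alternating-proper : ∀ {l} → Unique l → ∀ i {e f} → e ∈ pathEdges l → f ∈ pathEdges l →
                       e ≢ f → ShareEnd e f → alternating (pathEdges l) i e ≢ alternating (pathEdges l) i f
  alternating-proper {x ∷ y ∷ r} u i (here refl) (here refl) e≢f _ = contradiction refl e≢f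
  alternating-proper {x ∷ y ∷ r} u i (here refl) (there f∈) _ sh =
    let _ , v∈e , v∈f = ShareEnd⇒common sh in alternating-head≢ i u f∈ v∈e v∈f
  alternating-proper {x ∷ y ∷ r} u i (there e∈) (here refl) _ sh =
    let _ , v∈e , v∈f = ShareEnd⇒common sh in alternating-head≢ i u e∈ v∈f v∈e ∘ sym
  alternating-proper {x ∷ y ∷ r} u@(_ ∷ u′) i {e} {f} (there e∈) (there f∈) e≢f sh same =
    alternating-proper u′ (opposite i) e∈ f∈ e≢f sh (begin
      alternating (pathEdges (y ∷ r)) (opposite i) e
        ≡⟨ alternating-there (pathEdges (y ∷ r)) i (tail≢head u e∈) ⟨
      alternating (pathEdges (x ∷ y ∷ r)) i e
        ≡⟨ same ⟩
      alternating (pathEdges (x ∷ y ∷ r)) i f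
        ≡⟨ alternating-there (pathEdges (y ∷ r)) i (tail≢head u f∈) ⟩
      alternating (pathEdges (y ∷ r)) (opposite i) f
        ∎)
    where open ≡-Reasoning

  traceable⇒2-proper : SimplePath n → ∀ k → Σ (Coloring n 2) λ c → KProperColoring G k c
  traceable⇒2-proper (simplePath (x ∷ r) p u |l|≡n) k =
    alternating (pathEdges (x ∷ r)) zero ,
    λ _ → pathTree p u , alternating-proper u zero , λ {v} _ → ∈-complete u |l|≡n v

  Reach-adjacentEdge : ∀ {es : List (Fin n × Fin n)} {a b x w} → x ∈ ends (a , b) → w ∉ ends (a , b) →
                       Reach es x w → ∃ λ f → f ∈ es × f ≢ (a , b) × ShareEnd (a , b) f
  Reach-adjacentEdge x∈ w∉ here = contradiction x∈ w∉
  Reach-adjacentEdge {a = a} {b} {x} x∈ w∉ (fwd {v = v} e∈ r) with (x , v) ≟ₑ (a , b)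
  ... | yes refl = Reach-adjacentEdge (there (here refl)) w∉ r
  ... | no  e≢ab = _ , e∈ , e≢ab , share x∈
    where
    share : x ∈ ends (a , b) → ShareEnd (a , b) (x , v)
    share (here x≡a)         = inj₁ (sym x≡a)
    share (there (here x≡b)) = inj₂ (inj₂ (inj₁ (sym x≡b)))
  Reach-adjacentEdge {a = a} {b} {x} x∈ w∉ (bwd {v = v} e∈ r) with (v , x) ≟ₑ (a , b)
  ... | yes refl = Reach-adjacentEdge (here refl) w∉ r
  ... | no  e≢ab = _ , e∈ , e≢ab , share x∈
    where
    share : x ∈ ends (a , b) → ShareEnd (a , b) (v , x)
    share (here x≡a)         = inj₂ (inj₁ (sym x≡a))
    share (there (here x≡b)) = inj₂ (inj₂ (inj₂ (sym x≡b)))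

  Tree-edges-nonempty : (T : Tree G) → 2 ≤ length (vs T) → 0 < length (es T)
  Tree-edges-nonempty T 2≤|vs| = +-cancelʳ-≤ 1 1 (length (es T)) (subst (2 ≤_) (sym (size T)) 2≤|vs|)

  adjacentEdges : (T : Tree G) → 3 ≤ length (vs T) →
                  ∃₂ λ e f → e ∈ es T × f ∈ es T × e ≢ f × ShareEnd e f
  adjacentEdges T 3≤|vs| with nonempty⇒∃∈ (es T) (Tree-edges-nonempty T (≤-trans (n≤1+n 2) 3≤|vs|))
  ... | (a , b) , ab∈ with esEnds T ab∈
  ...   | a∈ , _ with ∃-outside-pair (vsUniq T) 3≤|vs| a b
  ...     | w , w∈ , w∉ with Reach-adjacentEdge (here refl) w∉ (conn T a∈ w∈)
  ...       | f , f∈ , f≢ab , sh = (a , b) , f , ab∈ , f∈ , f≢ab ∘ sym , sh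

  noProperColouring<2 : ∀ {k m} → 3 ≤ k → k ≤ n → m < 2 → (c : Coloring n m) → ¬ KProperColoring G k c
  noProperColouring<2 3≤k k≤n m<2 c kp with kp (initialSegment k≤n)
  ... | T , proper , S⊆vs with adjacentEdges T (≤-trans 3≤k (KSet-length≤ (initialSegment k≤n) S⊆vs))
  ...   | e , f , e∈ , f∈ , e≢f , sh = proper e∈ f∈ e≢f sh (Fin<2-irrelevant m<2 (c e) (c f))

corollary2p8 : (n : ℕ) (G : Graph n) → 3 ≤ n → MinDegreeAtLeastHalf G →
    (k : ℕ) → 3 ≤ k → k ≤ n → PxEq G k 2
corollary2p8 n G 3≤n δ k 3≤k k≤n =
  traceable⇒2-proper G (hamiltonianPath G (minDegree⇒degreeSums G δ) (≤-trans (s≤s z≤n) 3≤n)) k ,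
  λ _ m<2 → noProperColouring<2 G 3≤k k≤n m<2
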